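{- Let $m\ge2$ and $b\ge2$ be integers, and let $$N=N(m,b)=\prod_{\substack{p\text{ prime},\ (p-1)\mid(m-1),\\ p\le b-1}}p\ \cdot\prod_{\substack{p\text{ prime},\ p>b-1,\\ r-1=\mathrm{ord}_p(m-1),\ p^{r-1}(p-1)\mid(m-1)}}p^r.$$ Then $S_{x^m,b}$ has at least $\gcd(b-1,N)$ distinct cycles. In particular, if $m\ge5$ is prime and $b=mk+1$ for a positive integer $k$, then $S_{x^m,b}$ has at least $m$ distinct cycles.
   Context: For integers $b\ge2$, $m\ge2$, $S_{x^m,b}(n)=x_0^m+\dots+x_d^m$ where $n=x_0+x_1b+\dots+x_db^d$ is the base-$b$ expansion of $n\ge0$. A cycle of $S_{x^m,b}$ is a sequence of pairwise distinct positive integers $\mathrm{cyc}(n_1,\dots,n_\ell)$ with $S_{x^m,b}(n_i)=n_{i+1}$ ($1\le i<\ell$) and $S_{x^m,b}(n_\ell)=n_1$, considered up to cyclic permutation; the cycles of $S_{x^m,b}$ counted are those occurring in orbits $n,S_{x^m,b}(n),\dots$ of positive integers $n$. $\mathrm{ord}_p$ denotes the $p$-adic valuation. -}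

module Defs where

open import Data.Nat using (ℕ; zero; suc; _+_; _*_; _∸_; _^_; _≤_; _<_; _≤?_)
open import Data.Nat.DivMod using (_%_; _/_)
open import Data.Nat.Divisibility using (_∣_; _∣?_)
open import Data.Nat.Primality using (Prime; prime?)
open import Data.List using (List; []; _∷_; _++_; map; upTo; length)
open import Data.Nat.ListAction using (sum; product)
open import Data.List.Relation.Unary.All using (All)
open import Data.List.Relation.Unary.AllPairs using (AllPairs)
open import Data.Product using (Σ; ∃; _×_)
open import Relation.Binary.PropositionalEquality using (_≡_; _≢_)
open import Relation.Nullary using (¬_; yes; no)

-- Base-b digits (least significant first) of n; fuel argument bounds recursion.
-- For b ≥ 2, fuel n is enough; digits of 0 is the empty list (sum of powers 0).
digitsAux : ℕ → ℕ → ℕ → List ℕ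
digitsAux zero b n = []
digitsAux (suc f) b zero = []
digitsAux (suc f) zero (suc n) = []
digitsAux (suc f) (suc b') (suc n) =
  (suc n % suc b') ∷ digitsAux f (suc b') (suc n / suc b')

digits : ℕ → ℕ → List ℕ
digits b n = digitsAux n b n

S : ℕ → ℕ → ℕ → ℕ
S m b n = sum (map (λ x → x ^ m) (digits b n))

-- p-adic valuation ord_p(n) (meaningful for p ≥ 2, n ≥ 1; fuel n suffices)
ordAux : ℕ → ℕ → ℕ → ℕ
ordAux zero p n = 0
ordAux (suc f) zero n = 0
ordAux (suc f) (suc zero) n = 0
ordAux (suc f) (suc (suc q)) zero = 0
ordAux (suc f) (suc (suc q)) (suc n) with suc (suc q) ∣? suc n
... | yes _ = suc (ordAux f (suc (suc q)) (suc n / suc (suc q)))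
... | no _ = 0

ord : ℕ → ℕ → ℕ
ord p n = ordAux n p n

factorN : ℕ → ℕ → ℕ → ℕ
factorN m b p with prime? p
... | no _ = 1
... | yes _ with p ≤? b ∸ 1
...   | yes _ with (p ∸ 1) ∣? (m ∸ 1)
...     | yes _ = p
...     | no _ = 1
factorN m b p | yes _ | no _ with (p ^ ord p (m ∸ 1)) * (p ∸ 1) ∣? (m ∸ 1)
...     | yes _ = p ^ suc (ord p (m ∸ 1))
...     | no _ = 1

-- N(m,b): product over primes p.  Every prime contributing a factor ≠ 1
-- satisfies (p-1) | (m-1), hence p ≤ m (as m ≥ 2), so ranging over p < m + b + 1 covers all.
N : ℕ → ℕ → ℕ
N m b = product (map (factorN m b) (upTo (suc (m + b))))

rot1 : List ℕ → List ℕ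
rot1 [] = []
rot1 (x ∷ xs) = xs ++ (x ∷ [])

rotate : ℕ → List ℕ → List ℕ
rotate zero c = c
rotate (suc k) c = rotate k (rot1 c)

-- c = [n₁,…,n_ℓ] is a cycle of S_{x^m,b}: nonempty, positive, pairwise distinct,
-- S(n_i) = n_{i+1} and S(n_ℓ) = n₁  (i.e. map S c = rot1 c)
record IsCycle (m b : ℕ) (c : List ℕ) : Set where
  field
    nonempty : c ≢ []
    positive : All (λ x → 0 < x) c
    distinct : AllPairs _≢_ c
    closed   : map (S m b) c ≡ rot1 c

SameCycle : List ℕ → List ℕ → Set
SameCycle c d = ∃ λ k → rotate k c ≡ d

AtLeastCycles : ℕ → ℕ → ℕ → Set
AtLeastCycles m b K =
  Σ (List (List ℕ)) λ cs →
    (length cs ≡ K) × All (IsCycle m b) cs × AllPairs (λ c d → ¬ SameCycle c d) cs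

{-# OPTIONS --safe #-}
-- Let g = gcd (b - 1) N. Large primes p > b - 1 cannot divide b - 1, so g is a product of
-- distinct primes p with (p - 1) ∣ (m - 1); by Fermat x ^ m ≡ x (mod p) for each of them,
-- hence x ^ m ≡ x (mod g). As g ∣ b - 1, also b ≡ 1 (mod g), so S n ≡ Σ digits ≡ n (mod g).
-- Since 2 S n ≤ n + K for a constant K, every orbit is bounded and so reaches a cycle, which
-- stays in the residue class of its starting point; starting at g, g + 1, …, 2g - 1 gives g
-- cycles with pairwise different residues. If m is prime and b = mk + 1, then m ∣ g.
module Submission where

open import Defs
import Algebra.Properties.CommutativeSemiring.Binomial as Binomial
import Algebra.Properties.Semiring.Exp as Exp
import Algebra.Properties.Semiring.Mult as Mult
import Algebra.Properties.Semiring.Sum as SemiringSum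
open import Data.Empty using (⊥; ⊥-elim)
open import Data.Fin using (toℕ; fromℕ; fromℕ<; inject₁) renaming (zero to fzero; suc to fsuc)
open import Data.Fin.Properties using (toℕ<n; toℕ-fromℕ; toℕ-fromℕ<; toℕ-inject₁; pigeonhole)
open import Data.List using (List; []; _∷_; _∷ʳ_; map; upTo; applyUpTo; take)
open import Data.List.Membership.Propositional.Properties using (∈-map⁺; ∈-upTo⁺)
open import Data.List.Properties using (map-++; upTo-∷ʳ; map-applyUpTo; applyUpTo-∷ʳ; length-applyUpTo; length-take)
open import Data.List.Relation.Unary.All using (All; []; _∷_)
import Data.List.Relation.Unary.All as All
import Data.List.Relation.Unary.All.Properties as All
import Data.List.Relation.Unary.AllPairs.Properties as AllPairs
open import Data.Nat
open import Data.Nat.Combinatorics using (_C_; nCn≡1; k![n∸k]!∣n!)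
open import Data.Nat.Combinatorics.Specification using (nCk≡n!/k![n-k]!)
open import Data.Nat.Coprimality using (Coprime; coprime-divisor)
import Data.Nat.Coprimality as Coprime
open import Data.Nat.Divisibility
open import Data.Nat.DivMod
open import Data.Nat.GCD using (gcd; gcd[m,n]∣m; gcd[m,n]∣n; gcd[m,n]≢0; gcd-greatest)
open import Data.Nat.Induction using (<-rec)
open import Data.Nat.ListAction using (sum; product)
open import Data.Nat.ListAction.Properties using (product-++; ∈⇒∣product)
open import Data.Nat.Primality
open import Data.Nat.Properties
open import Algebra.Properties.CommutativeSemigroup *-commutativeSemigroup using (x∙yz≈y∙xz)
open import Data.Nat.Tactic.RingSolver using (solve-∀)
open import Data.Product using (∃; _,_; _×_; proj₁; proj₂)
open import Data.Sum using (_⊎_; inj₁; inj₂)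
open import Data.Vec.Functional using (Vector; init; last; tail)
open import Function.Base using (_∘_; _∘′_)
open import Relation.Binary.PropositionalEquality
open import Relation.Nullary using (¬_; yes; no)
open import Relation.Unary using (Pred; Decidable)

-- Fermat's little theorem

PowFixesResidues : ℕ → ℕ → Set
PowFixesResidues m d = ∀ x → ∃ λ t → x ^ m ≡ x + t * d

prime∤1 : ∀ {p} → Prime p → ¬ p ∣ 1
prime∤1 {p} pr p∣1 = <⇒≢ (nonTrivial⇒n>1 p {{prime⇒nonTrivial pr}}) (sym (∣1⇒≡1 p∣1))

prime∤k! : ∀ {p} → Prime p → ∀ k → k < p → ¬ p ∣ k !
prime∤k! pr zero k<p = prime∤1 pr
prime∤k! pr (suc k) k<p p∣k! with euclidsLemma (suc k) (k !) pr p∣k!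
... | inj₁ p∣1+k = <⇒≱ k<p (∣⇒≤ p∣1+k)
... | inj₂ p∣k!′ = prime∤k! pr k (<-trans (n<1+n k) k<p) p∣k!′

nCk*k![n∸k]!≡n! : ∀ {n k} → k ≤ n → (n C k) * (k ! * (n ∸ k) !) ≡ n !
nCk*k![n∸k]!≡n! {n} {k} k≤n = trans (cong (_* (k ! * (n ∸ k) !)) (nCk≡n!/k![n-k]! k≤n))
                                    (m/n*n≡m {{k !* (n ∸ k) !≢0}} (k![n∸k]!∣n! k≤n))

prime∣pCk : ∀ {p k} → Prime p → 0 < k → k < p → p ∣ p C k
prime∣pCk {p@(suc q)} {k} pr 0<k k<p
  with euclidsLemma (p C k) (k ! * (p ∸ k) !) pr
         (subst (p ∣_) (sym (nCk*k![n∸k]!≡n! (<⇒≤ k<p))) (m∣m*n (q !)))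
... | inj₁ p∣pCk = p∣pCk
... | inj₂ p∣k![p∸k]! with euclidsLemma (k !) ((p ∸ k) !) pr p∣k![p∸k]!
...   | inj₁ p∣k! = ⊥-elim (prime∤k! pr k k<p p∣k!)
...   | inj₂ p∣[p∸k]! = ⊥-elim (prime∤k! pr (p ∸ k) (∸-monoʳ-< 0<k (<⇒≤ k<p)) p∣[p∸k]!)

private
  module ℕ-Binomial = Binomial +-*-commutativeSemiring
  module ℕ-Exp = Exp +-*-semiring
  module ℕ-Mult = Mult +-*-semiring
  module ℕ-Sum = SemiringSum +-*-semiring

  ℕ-Exp^≡^ : ∀ x n → x ℕ-Exp.^ n ≡ x ^ n
  ℕ-Exp^≡^ x zero = refl
  ℕ-Exp^≡^ x (suc n) = cong (x *_) (ℕ-Exp^≡^ x n)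

  ℕ-Mult×≡* : ∀ n x → n ℕ-Mult.× x ≡ n * x
  ℕ-Mult×≡* zero x = refl
  ℕ-Mult×≡* (suc n) x = cong (x +_) (ℕ-Mult×≡* n x)

∣-sum : ∀ {d n} (t : Vector ℕ n) → (∀ i → d ∣ t i) → d ∣ ℕ-Sum.sum t
∣-sum {n = zero} t d∣t = _ ∣0
∣-sum {n = suc n} t d∣t = ∣m∣n⇒∣m+n (d∣t fzero) (∣-sum (tail t) (d∣t ∘ fsuc))

[x+1]^p≡1+x^p : ∀ {p} → Prime p → ∀ x → ∃ λ M → p ∣ M × (x + 1) ^ p ≡ 1 + M + x ^ p
[x+1]^p≡1+x^p {p@(suc (suc q))} pr x = ℕ-Sum.sum inner , ∣-sum inner p∣inner , (begin
  (x + 1) ^ p                             ≡⟨ ℕ-Exp^≡^ (x + 1) p ⟨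
  (x + 1) ℕ-Exp.^ p                       ≡⟨ ℕ-Binomial.theorem p x 1 ⟩
  term fzero + ℕ-Sum.sum (tail term)      ≡⟨ cong (term fzero +_) (ℕ-Sum.sum-init-last (tail term)) ⟩
  term fzero + (ℕ-Sum.sum inner + last (tail term)) ≡⟨ +-assoc (term fzero) _ _ ⟨
  term fzero + ℕ-Sum.sum inner + last (tail term)   ≡⟨ cong₂ (λ a b → a + ℕ-Sum.sum inner + b) first≡1 last≡x^p ⟩
  1 + ℕ-Sum.sum inner + x ^ p             ∎)
  where
  open ≡-Reasoning
  term : Vector ℕ (suc p)
  term = ℕ-Binomial.binomialTerm x 1 p
  inner : Vector ℕ (suc q)
  inner = init (tail term)
  p∣inner : ∀ i → p ∣ inner i
  p∣inner i = subst (p ∣_) (sym (ℕ-Mult×≡* (p C suc (toℕ (inject₁ i))) _))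
    (∣m⇒∣m*n _ (prime∣pCk pr (s≤s z≤n) (s≤s (subst (_< suc q) (sym (toℕ-inject₁ i)) (toℕ<n i)))))
  first≡1 : term fzero ≡ 1
  first≡1 = begin
    term fzero                       ≡⟨ ℕ-Mult×≡* 1 _ ⟩
    1 * (1 * 1 ℕ-Exp.^ p)            ≡⟨ cong (λ y → 1 * (1 * y)) (ℕ-Exp^≡^ 1 p) ⟩
    1 * (1 * 1 ^ p)                  ≡⟨ cong (λ y → 1 * (1 * y)) (^-zeroˡ p) ⟩
    1                                ∎
  last≡x^p : last (tail term) ≡ x ^ p
  last≡x^p = begin
    last (tail term)                 ≡⟨ ℕ-Mult×≡* (p C toℕ (fromℕ p)) _ ⟩
    (p C toℕ (fromℕ p)) * (x ℕ-Exp.^ toℕ (fromℕ p) * 1 ℕ-Exp.^ (p ∸ toℕ (fromℕ p)))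
                                     ≡⟨ cong (λ k → (p C k) * (x ℕ-Exp.^ k * 1 ℕ-Exp.^ (p ∸ k))) (toℕ-fromℕ p) ⟩
    (p C p) * (x ℕ-Exp.^ p * 1 ℕ-Exp.^ (p ∸ p))
                                     ≡⟨ cong₂ (λ c k → c * (x ℕ-Exp.^ p * 1 ℕ-Exp.^ k)) (nCn≡1 p) (n∸n≡0 p) ⟩
    1 * (x ℕ-Exp.^ p * 1)            ≡⟨ trans (*-identityˡ _) (*-identityʳ _) ⟩
    x ℕ-Exp.^ p                      ≡⟨ ℕ-Exp^≡^ x p ⟩
    x ^ p                            ∎

fermat : ∀ {p} → Prime p → PowFixesResidues p p
fermat {suc _} pr zero = 0 , refl
fermat {p} pr (suc x) with [x+1]^p≡1+x^p pr x | fermat pr x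
... | M , divides s refl , [x+1]^p≡ | t , x^p≡ = s + t , (begin
  suc x ^ p                 ≡⟨ cong (_^ p) (+-comm 1 x) ⟩
  (x + 1) ^ p               ≡⟨ [x+1]^p≡ ⟩
  1 + s * p + x ^ p         ≡⟨ cong (1 + s * p +_) x^p≡ ⟩
  1 + s * p + (x + t * p)   ≡⟨ regroup x s t p ⟩
  suc x + (s + t) * p       ∎)
  where
  open ≡-Reasoning
  regroup : ∀ x s t p → 1 + s * p + (x + t * p) ≡ suc x + (s + t) * p
  regroup = solve-∀

powFixesResidues-1 : ∀ d → PowFixesResidues 1 d
powFixesResidues-1 d x = 0 , trans (*-identityʳ x) (sym (+-identityʳ x))

powFixesResidues-+ : ∀ {i j d} → PowFixesResidues (suc i) d → PowFixesResidues (suc j) d →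
                     PowFixesResidues (suc (i + j)) d
powFixesResidues-+ {i} {j} {d} fixᵢ fixⱼ x with fixᵢ x | fixⱼ x
... | s , x^[1+i]≡ | t , x^[1+j]≡ = s + x ^ i * t , (begin
  x ^ suc (i + j)               ≡⟨ cong (x ^_) (sym (+-suc i j)) ⟩
  x ^ (i + suc j)               ≡⟨ ^-distribˡ-+-* x i (suc j) ⟩
  x ^ i * x ^ suc j             ≡⟨ cong (x ^ i *_) x^[1+j]≡ ⟩
  x ^ i * (x + t * d)           ≡⟨ *-distribˡ-+ (x ^ i) x (t * d) ⟩
  x ^ i * x + x ^ i * (t * d)   ≡⟨ cong (_+ x ^ i * (t * d)) (trans (*-comm (x ^ i) x) x^[1+i]≡) ⟩
  x + s * d + x ^ i * (t * d)   ≡⟨ regroup x s (x ^ i) t d ⟩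
  x + (s + x ^ i * t) * d       ∎)
  where
  open ≡-Reasoning
  regroup : ∀ x s a t d → x + s * d + a * (t * d) ≡ x + (s + a * t) * d
  regroup = solve-∀

fermat-[p∸1]∣[m∸1] : ∀ {p m} → Prime p → (p ∸ 1) ∣ (m ∸ 1) → 1 ≤ m → PowFixesResidues m p
fermat-[p∸1]∣[m∸1] {p@(suc q)} {suc _} pr (divides k refl) _ = go k
  where
  go : ∀ k → PowFixesResidues (suc (k * q)) p
  go zero = powFixesResidues-1 p
  go (suc k) = powFixesResidues-+ {q} {k * q} (fermat pr) (go k)

powFixesResidues-∣ : ∀ {m d e} → e ∣ d → PowFixesResidues m d → PowFixesResidues m e
powFixesResidues-∣ (divides k refl) fix x with fix x
... | t , x^m≡ = t * k , trans x^m≡ (cong (x +_) (sym (*-assoc t k _)))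

powFixesResidues-* : ∀ {m d e} → Coprime d e →
                     PowFixesResidues m d → PowFixesResidues m e → PowFixesResidues m (d * e)
powFixesResidues-* {m} {d} {e} d⊥e fix-d fix-e x with fix-d x | fix-e x
... | s , x^m≡x+sd | t , x^m≡x+te
  with coprime-divisor d⊥e (divides s (trans (*-comm e t) (+-cancelˡ-≡ x _ _ (trans (sym x^m≡x+te) x^m≡x+sd))))
... | divides r refl = r , trans x^m≡x+te (cong (x +_) (*-assoc r d e))

powFixesResidues-mod1 : ∀ {m} → 1 ≤ m → PowFixesResidues m 1
powFixesResidues-mod1 {m} 1≤m = powFixesResidues-∣ {m} (divides 2 refl)
  (fermat-[p∸1]∣[m∸1] prime[2] (divides (m ∸ 1) (sym (*-identityʳ _))) 1≤m)

-- The factors of N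

prime∤⇒coprime : ∀ {p n} → Prime p → ¬ p ∣ n → Coprime p n
prime∤⇒coprime pr p∤n (i∣p , i∣n) with prime⇒irreducible pr i∣p
... | inj₁ i≡1 = i≡1
... | inj₂ refl = ⊥-elim (p∤n i∣n)

prime∣^⇒∣ : ∀ {p n} → Prime p → ∀ e → p ∣ n ^ e → p ∣ n
prime∣^⇒∣ pr zero p∣1 = ⊥-elim (prime∤1 pr p∣1)
prime∣^⇒∣ {n = n} pr (suc e) p∣n^[1+e] with euclidsLemma n (n ^ e) pr p∣n^[1+e]
... | inj₁ p∣n = p∣n
... | inj₂ p∣n^e = prime∣^⇒∣ pr e p∣n^e

coprime-divisor-^ : ∀ {d q a} → Coprime d q → ∀ e → d ∣ a * q ^ e → d ∣ a
coprime-divisor-^ {a = a} _ zero d∣a*1 = subst (_ ∣_) (*-identityʳ a) d∣a*1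
coprime-divisor-^ {d} {q} {a} d⊥q (suc e) d∣a*q^[1+e] =
  coprime-divisor-^ d⊥q e (coprime-divisor d⊥q (subst (d ∣_) (x∙yz≈y∙xz a q (q ^ e)) d∣a*q^[1+e]))

∣*prime⇒∣⊎∣ : ∀ {p a d} → Prime p → ¬ p ∣ a → d ∣ a * p →
              d ∣ a ⊎ ∃ λ d′ → d ≡ d′ * p × d′ ∣ a
∣*prime⇒∣⊎∣ {p} {a} {d} pr p∤a d∣ap with p ∣? d
... | no p∤d = inj₁ (coprime-divisor (Coprime.sym (prime∤⇒coprime pr p∤d)) (subst (d ∣_) (*-comm a p) d∣ap))
... | yes (divides d′ refl) = inj₂ (d′ , refl , *-cancelʳ-∣ p {{prime⇒nonZero pr}} d∣ap)

product-map-upTo-suc : ∀ (f : ℕ → ℕ) n → product (map f (upTo (suc n))) ≡ product (map f (upTo n)) * f n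
product-map-upTo-suc f n = begin
  product (map f (upTo (suc n)))           ≡⟨ cong (product ∘′ map f) (upTo-∷ʳ n) ⟨
  product (map f (upTo n ∷ʳ n))            ≡⟨ cong product (map-++ f (upTo n) (n ∷ [])) ⟩
  product (map f (upTo n) ∷ʳ f n)          ≡⟨ product-++ (map f (upTo n)) (f n ∷ []) ⟩
  product (map f (upTo n)) * (f n * 1)     ≡⟨ cong (product (map f (upTo n)) *_) (*-identityʳ (f n)) ⟩
  product (map f (upTo n)) * f n           ∎
  where open ≡-Reasoning

data FactorN (m b p : ℕ) : ℕ → Set where
  trivial : FactorN m b p 1
  small   : Prime p → p ≤ b ∸ 1 → (p ∸ 1) ∣ (m ∸ 1) → FactorN m b p p
  large   : Prime p → b ∸ 1 < p → ∀ e → FactorN m b p (p ^ e)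

factorN-view : ∀ m b p → FactorN m b p (factorN m b p)
factorN-view m b p with prime? p
... | no _ = trivial
... | yes pr with p ≤? b ∸ 1
...   | yes p≤b-1 with (p ∸ 1) ∣? (m ∸ 1)
...     | yes p-1∣m-1 = small pr p≤b-1 p-1∣m-1
...     | no _ = trivial
factorN-view m b p | yes pr | no p≰b-1 with (p ^ ord p (m ∸ 1)) * (p ∸ 1) ∣? (m ∸ 1)
...     | yes _ = large pr (≰⇒> p≰b-1) (suc (ord p (m ∸ 1)))
...     | no _ = trivial

factorN-small : ∀ {m b p} → Prime p → p ≤ b ∸ 1 → (p ∸ 1) ∣ (m ∸ 1) → factorN m b p ≡ p
factorN-small {m} {b} {p} pr p≤b-1 p-1∣m-1 with prime? p
... | no ¬pr = ⊥-elim (¬pr pr)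
... | yes _ with p ≤? b ∸ 1
...   | no p≰b-1 = ⊥-elim (p≰b-1 p≤b-1)
...   | yes _ with (p ∸ 1) ∣? (m ∸ 1)
...     | yes _ = refl
...     | no ∤ = ⊥-elim (∤ p-1∣m-1)

prime∣N : ∀ {m b p} → Prime p → p ≤ b ∸ 1 → (p ∸ 1) ∣ (m ∸ 1) → p ∣ N m b
prime∣N {m} {b} {p} pr p≤b-1 p-1∣m-1 = subst (_∣ N m b) (factorN-small pr p≤b-1 p-1∣m-1)
  (∈⇒∣product (∈-map⁺ (factorN m b) (∈-upTo⁺ (s≤s (≤-trans p≤b-1 (≤-trans (m∸n≤m b 1) (m≤n+m b m)))))))

module _ (m b : ℕ) where

  ∏factorN : ℕ → ℕ
  ∏factorN n = product (map (factorN m b) (upTo n))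

  ∏factorN-suc : ∀ n → ∏factorN (suc n) ≡ ∏factorN n * factorN m b n
  ∏factorN-suc = product-map-upTo-suc (factorN m b)

  prime∣∏factorN⇒< : ∀ n {q} → Prime q → q ∣ ∏factorN n → q < n
  prime∣∏factorN⇒< zero pr q∣1 = ⊥-elim (prime∤1 pr q∣1)
  prime∣∏factorN⇒< (suc n) {q} pr q∣∏
    with euclidsLemma (∏factorN n) (factorN m b n) pr (subst (q ∣_) (∏factorN-suc n) q∣∏)
  ... | inj₁ q∣∏n = m<n⇒m<1+n (prime∣∏factorN⇒< n pr q∣∏n)
  ... | inj₂ q∣f = s≤s (prime∣factor⇒≤ (factorN-view m b n) q∣f)
    where
    prime∣factor⇒≤ : ∀ {v} → FactorN m b n v → q ∣ v → q ≤ n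
    prime∣factor⇒≤ trivial q∣1 = ⊥-elim (prime∤1 pr q∣1)
    prime∣factor⇒≤ (small prn _ _) q∣n = ∣⇒≤ {{prime⇒nonZero prn}} q∣n
    prime∣factor⇒≤ (large prn _ e) q∣n^e = ∣⇒≤ {{prime⇒nonZero prn}} (prime∣^⇒∣ pr e q∣n^e)

  -- Peeling off factorN n: a small prime n divides ∏factorN (suc n) only once, since the primes
  -- dividing ∏factorN n are < n; a large prime exceeds b - 1, so its powers are coprime to d.
  powFixesResidues-∏factorN : .{{NonZero (b ∸ 1)}} → 1 ≤ m → ∀ n {d} → d ∣ b ∸ 1 → d ∣ ∏factorN n →
                              PowFixesResidues m d
  powFixesResidues-∏factorN 1≤m zero d∣b-1 d∣1 rewrite ∣1⇒≡1 d∣1 = powFixesResidues-mod1 1≤m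
  powFixesResidues-∏factorN 1≤m (suc n) {d} d∣b-1 d∣∏ =
    step (factorN-view m b n) (subst (d ∣_) (∏factorN-suc n) d∣∏)
    where
    IH : ∀ {d} → d ∣ b ∸ 1 → d ∣ ∏factorN n → PowFixesResidues m d
    IH = powFixesResidues-∏factorN 1≤m n
    n∤∏ : Prime n → ¬ n ∣ ∏factorN n
    n∤∏ prn n∣∏ = <-irrefl refl (prime∣∏factorN⇒< n prn n∣∏)
    step : ∀ {v} → FactorN m b n v → d ∣ ∏factorN n * v → PowFixesResidues m d
    step trivial d∣∏*1 = IH d∣b-1 (subst (d ∣_) (*-identityʳ _) d∣∏*1)
    step (small prn _ n-1∣m-1) d∣∏*n with ∣*prime⇒∣⊎∣ prn (n∤∏ prn) d∣∏*n
    ... | inj₁ d∣∏ = IH d∣b-1 d∣∏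
    ... | inj₂ (d′ , refl , d′∣∏) =
      powFixesResidues-* {m} d′⊥n (IH (∣-trans (m∣m*n n) d∣b-1) d′∣∏) (fermat-[p∸1]∣[m∸1] prn n-1∣m-1 1≤m)
      where
      d′⊥n : Coprime d′ n
      d′⊥n = Coprime.sym (prime∤⇒coprime prn (λ n∣d′ → n∤∏ prn (∣-trans n∣d′ d′∣∏)))
    step (large prn b-1<n e) d∣∏*n^e = IH d∣b-1 (coprime-divisor-^ d⊥n e d∣∏*n^e)
      where
      d⊥n : Coprime d n
      d⊥n = Coprime.sym (prime∤⇒coprime prn (λ n∣d → >⇒∤ b-1<n (∣-trans n∣d d∣b-1)))

-- Digit power sums

module _ (c : ℕ) where

  private
    b : ℕ
    b = 2 + c

  [1+n]/b≤n : ∀ n → suc n / b ≤ n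
  [1+n]/b≤n n = <⇒≤pred (m/n<m (suc n) b (s≤s (s≤s z≤n)))

  digitsAux-fuel : ∀ {f f′} n → n ≤ f → n ≤ f′ → digitsAux f b n ≡ digitsAux f′ b n
  digitsAux-fuel {zero}  {zero}   zero _ _ = refl
  digitsAux-fuel {zero}  {suc _}  zero _ _ = refl
  digitsAux-fuel {suc _} {zero}   zero _ _ = refl
  digitsAux-fuel {suc _} {suc _}  zero _ _ = refl
  digitsAux-fuel {suc f} {suc f′} (suc n) (s≤s n≤f) (s≤s n≤f′) =
    cong (suc n % b ∷_) (digitsAux-fuel (suc n / b) (≤-trans ([1+n]/b≤n n) n≤f) (≤-trans ([1+n]/b≤n n) n≤f′))

  S-suc : ∀ m n → S m b (suc n) ≡ (suc n % b) ^ m + S m b (suc n / b)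
  S-suc m n = cong (λ ds → (suc n % b) ^ m + sum (map (λ x → x ^ m) ds))
                   (digitsAux-fuel (suc n / b) ([1+n]/b≤n n) ≤-refl)

  [1+n]/b<1+n : ∀ n → suc n / b < suc n
  [1+n]/b<1+n n = s≤s ([1+n]/b≤n n)

  digit^m≤b^m : ∀ m n → (suc n % b) ^ m ≤ b ^ m
  digit^m≤b^m m n = ^-monoˡ-≤ m (<⇒≤ (m%n<n (suc n) b))

  S-pos : ∀ m n → 0 < n → 0 < S m b n
  S-pos m = <-rec (λ n → 0 < n → 0 < S m b n) pos
    where
    pos : ∀ n → (∀ {k} → k < n → 0 < k → 0 < S m b k) → 0 < n → 0 < S m b n
    pos (suc n) IH _ = subst (0 <_) (sym (S-suc m n)) (pos-step (suc n / b) refl)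
      where
      pos-step : ∀ q → suc n / b ≡ q → 0 < (suc n % b) ^ m + S m b q
      pos-step zero q≡0 = ≤-trans (subst (λ d → 0 < d ^ m) (sym (m<n⇒m%n≡m (m/n≡0⇒m<n {suc n} {b} q≡0)))
                                         (m^n>0 (suc n) m))
                                  (m≤m+n _ (S m b 0))
      pos-step (suc q) q≡ = ≤-trans (IH (subst (_< suc n) q≡ ([1+n]/b<1+n n)) (s≤s z≤n)) (m≤n+m _ ((suc n % b) ^ m))

  S-mod : ∀ {m g} .{{_ : NonZero g}} → g ∣ 1 + c → PowFixesResidues m g → ∀ n → S m b n % g ≡ n % g
  S-mod {m} {g} g∣b-1 fix = <-rec (λ n → S m b n % g ≡ n % g) mod
    where
    mod : ∀ n → (∀ {k} → k < n → S m b k % g ≡ k % g) → S m b n % g ≡ n % g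
    mod zero _ = refl
    mod (suc n) IH = begin
      S m b (suc n) % g                   ≡⟨ cong (_% g) (S-suc m n) ⟩
      (d ^ m + S m b q) % g               ≡⟨ %-distribˡ-+ (d ^ m) (S m b q) g ⟩
      (d ^ m % g + S m b q % g) % g       ≡⟨ cong₂ (λ u v → (u + v) % g) d^m%g≡d%g (IH ([1+n]/b<1+n n)) ⟩
      (d % g + q % g) % g                 ≡⟨ %-distribˡ-+ d q g ⟨
      (d + q) % g                         ≡⟨ %-remove-+ʳ (d + q) (∣n⇒∣m*n q g∣b-1) ⟨
      (d + q + q * (1 + c)) % g           ≡⟨ cong (_% g) (regroup d q c) ⟩
      (d + q * b) % g                     ≡⟨ cong (_% g) (m≡m%n+[m/n]*n (suc n) b) ⟨
      suc n % g                           ∎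
      where
      open ≡-Reasoning
      d q : ℕ
      d = suc n % b
      q = suc n / b
      d^m%g≡d%g : d ^ m % g ≡ d % g
      d^m%g≡d%g with fix d
      ... | t , d^m≡ = trans (cong (_% g) d^m≡) ([m+kn]%n≡m%n d t g)
      regroup : ∀ d q c → d + q + q * (1 + c) ≡ d + q * (2 + c)
      regroup = solve-∀

  S-≤ : ∀ m n → S m b n ≤ b ^ m * n
  S-≤ m = <-rec (λ n → S m b n ≤ b ^ m * n) bound
    where
    bound : ∀ n → (∀ {k} → k < n → S m b k ≤ b ^ m * k) → S m b n ≤ b ^ m * n
    bound zero _ = z≤n
    bound (suc n) IH = begin
      S m b (suc n)                        ≡⟨ S-suc m n ⟩
      (suc n % b) ^ m + S m b (suc n / b)  ≤⟨ +-mono-≤ (digit^m≤b^m m n) (IH ([1+n]/b<1+n n)) ⟩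
      b ^ m + b ^ m * (suc n / b)          ≤⟨ +-monoʳ-≤ (b ^ m) (*-monoʳ-≤ (b ^ m) ([1+n]/b≤n n)) ⟩
      b ^ m + b ^ m * n                    ≡⟨ *-suc (b ^ m) n ⟨
      b ^ m * suc n                        ∎
      where open ≤-Reasoning

  S-contracting : ∀ m → ∃ λ K → ∀ n → 2 * S m b n ≤ n + K
  -- Above 4 b ^ m the quotient q = n / b is at most n / 2, and S n ≤ b ^ m + S q;
  -- below it the crude bound S n ≤ b ^ m n suffices.
  S-contracting m = K , <-rec (λ n → 2 * S m b n ≤ n + K) contract
    where
    M K : ℕ
    M = b ^ m
    K = 2 * (M * (4 * M))
    contract : ∀ n → (∀ {k} → k < n → 2 * S m b k ≤ k + K) → 2 * S m b n ≤ n + K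
    contract zero _ = z≤n
    contract (suc n) IH with suc n <? 4 * M
    ... | yes 1+n<4M = ≤-trans (*-monoʳ-≤ 2 (≤-trans (S-≤ m (suc n)) (*-monoʳ-≤ M (<⇒≤ 1+n<4M)))) (m≤n+m K (suc n))
    ... | no 1+n≮4M = begin
      2 * S m b (suc n)                     ≡⟨ cong (2 *_) (S-suc m n) ⟩
      2 * ((suc n % b) ^ m + S m b q)       ≡⟨ *-distribˡ-+ 2 ((suc n % b) ^ m) (S m b q) ⟩
      2 * (suc n % b) ^ m + 2 * S m b q     ≤⟨ +-mono-≤ (*-monoʳ-≤ 2 (digit^m≤b^m m n)) (IH ([1+n]/b<1+n n)) ⟩
      2 * M + (q + K)                       ≡⟨ +-assoc (2 * M) q K ⟨
      2 * M + q + K                         ≤⟨ +-monoˡ-≤ K (*-cancelˡ-≤ {2 * M + q} {suc n} 2 2*[2M+q]≤2*[1+n]) ⟩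
      suc n + K                             ∎
      where
      open ≤-Reasoning
      q : ℕ
      q = suc n / b
      2q≤1+n : 2 * q ≤ suc n
      2q≤1+n = ≤-trans (≤-trans (≤-reflexive (*-comm 2 q)) (*-monoʳ-≤ q (s≤s (s≤s z≤n)))) (m/n*n≤m (suc n) b)
      2*[2M+q]≤2*[1+n] : 2 * (2 * M + q) ≤ 2 * suc n
      2*[2M+q]≤2*[1+n] = begin
        2 * (2 * M + q)        ≡⟨ *-distribˡ-+ 2 (2 * M) q ⟩
        2 * (2 * M) + 2 * q    ≡⟨ cong (_+ 2 * q) (*-assoc 2 2 M) ⟨
        4 * M + 2 * q          ≤⟨ +-mono-≤ (≮⇒≥ 1+n≮4M) 2q≤1+n ⟩
        suc n + suc n          ≡⟨ cong (suc n +_) (+-identityʳ (suc n)) ⟨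
        2 * suc n              ∎

-- Orbits

least-witness : ∀ {p} {P : Pred ℕ p} → Decidable P → ∀ {n} → P n → ∃ λ k → P k × (∀ j → j < k → ¬ P j)
least-witness {P = P} P? {n} Pn = search n 0 (+-identityʳ n) (λ _ ())
  where
  search : ∀ r i → r + i ≡ n → (∀ j → j < i → ¬ P j) → ∃ λ k → P k × (∀ j → j < k → ¬ P j)
  search zero i refl below = i , Pn , below
  search (suc r) i r+i≡n below with P? i
  ... | yes Pi = i , Pi , below
  ... | no ¬Pi = search r (suc i) (trans (+-suc r i) r+i≡n) below′
    where
    below′ : ∀ j → j < suc i → ¬ P j
    below′ j j<1+i with m≤n⇒m<n∨m≡n (≤-pred j<1+i)
    ... | inj₁ j<i = below j j<i
    ... | inj₂ refl = ¬Pi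

module _ (s : ℕ → ℕ) where

  iter : ℕ → ℕ → ℕ
  iter zero x = x
  iter (suc k) x = s (iter k x)

  iter-+ : ∀ i j x → iter (i + j) x ≡ iter i (iter j x)
  iter-+ zero j x = refl
  iter-+ (suc i) j x = cong s (iter-+ i j x)

  iter-preserves : ∀ {p} {P : Pred ℕ p} → (∀ {x} → P x → P (s x)) → ∀ k {x} → P x → P (iter k x)
  iter-preserves s-pres zero Px = Px
  iter-preserves {P = P} s-pres (suc k) Px = s-pres (iter-preserves {P = P} s-pres k Px)

  invariantSegment : ∀ K → (∀ x → 2 * s x ≤ x + K) → ∀ n → ∃ λ B → n ≤ B × (∀ {x} → x ≤ B → s x ≤ B)
  invariantSegment K contracting n = n + K , m≤m+n n K , λ {x} x≤B →
    *-cancelˡ-≤ 2 (≤-trans (contracting x) (+-mono-≤ x≤B (≤-trans (m≤n+m K n) (m≤m+n (n + K) 0))))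

  periodicPointInOrbit : ∀ {B} → (∀ {x} → x ≤ B → s x ≤ B) → ∀ {n} → n ≤ B →
                         ∃ λ i → ∃ λ p → 0 < p × iter p (iter i n) ≡ iter i n
  periodicPointInOrbit {B} invariant {n} n≤B with pigeonhole (n<1+n (suc B)) (λ i → fromℕ< (s≤s (iter≤B (toℕ i))))
    where
    iter≤B : ∀ k → iter k n ≤ B
    iter≤B k = iter-preserves {P = _≤ B} invariant k n≤B
  ... | i , j , i<j , iterᵢ≡iterⱼ = toℕ i , toℕ j ∸ toℕ i , m<n⇒0<n∸m i<j , (begin
    iter (toℕ j ∸ toℕ i) (iter (toℕ i) n)   ≡⟨ iter-+ (toℕ j ∸ toℕ i) (toℕ i) n ⟨
    iter (toℕ j ∸ toℕ i + toℕ i) n          ≡⟨ cong (λ k → iter k n) (m∸n+n≡m (<⇒≤ i<j)) ⟩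
    iter (toℕ j) n                          ≡⟨ toℕ-fromℕ< _ ⟨
    toℕ (fromℕ< _)                          ≡⟨ cong toℕ iterᵢ≡iterⱼ ⟨
    toℕ (fromℕ< _)                          ≡⟨ toℕ-fromℕ< _ ⟩
    iter (toℕ i) n                          ∎)
    where open ≡-Reasoning

-- Cycles of S

rotate-All : ∀ {p} {P : ℕ → Set p} k c → All P c → All P (rotate k c)
rotate-All zero c Pc = Pc
rotate-All (suc k) [] [] = rotate-All k [] []
rotate-All (suc k) (x ∷ c) (Px ∷ Pc) = rotate-All k (c ∷ʳ x) (All.∷ʳ⁺ Pc Px)

atLeastCycles-≤ : ∀ {m b K K′} → K ≤ K′ → AtLeastCycles m b K′ → AtLeastCycles m b K
atLeastCycles-≤ {K = K} K≤K′ (cycles , refl , areCycles , distinct) =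
  take K cycles , trans (length-take K cycles) (m≤n⇒m⊓n≡m K≤K′) , All.take⁺ K areCycles , AllPairs.take⁺ K distinct

module _ (m c : ℕ) where

  private
    b : ℕ
    b = 2 + c
    s : ℕ → ℕ
    s = S m b

  orbitList : ℕ → ℕ → List ℕ
  orbitList x q = applyUpTo (λ i → iter s i x) q

  orbitList-isCycle : ∀ {x} k → 0 < x → iter s (suc k) x ≡ x → (∀ j → j < k → iter s (suc j) x ≢ x) →
                      IsCycle m b (orbitList x (suc k))
  orbitList-isCycle {x} k 0<x returns minimal = record
    { nonempty = λ ()
    ; positive = All.applyUpTo⁺₂ (λ i → iter s i x) (suc k) (λ i → iter-preserves s {P = 0 <_} (S-pos c m _) i 0<x)
    ; distinct = AllPairs.applyUpTo⁺₁ (λ i → iter s i x) (suc k) distinct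
    ; closed   = begin
        map s (orbitList x (suc k))            ≡⟨ map-applyUpTo (λ i → iter s i x) s (suc k) ⟩
        applyUpTo next (suc k)                 ≡⟨ applyUpTo-∷ʳ next k ⟨
        applyUpTo next k ∷ʳ iter s (suc k) x   ≡⟨ cong (applyUpTo next k ∷ʳ_) returns ⟩
        rot1 (orbitList x (suc k))             ∎
    }
    where
    open ≡-Reasoning
    next : ℕ → ℕ
    next i = iter s (suc i) x
    noEarlyReturn : ∀ r → 0 < r → r < suc k → iter s r x ≢ x
    noEarlyReturn (suc r) _ (s≤s r<k) = minimal r r<k
    distinct : ∀ {i j} → i < j → j < suc k → iter s i x ≢ iter s j x
    distinct {i} {j} i<j j<q iterᵢ≡iterⱼ = noEarlyReturn (suc k ∸ j + i)
      (≤-trans (m<n⇒0<n∸m j<q) (m≤m+n _ i))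
      (≤-trans (+-monoʳ-< (suc k ∸ j) i<j) (≤-reflexive (m∸n+n≡m (<⇒≤ j<q))))
      (begin
        iter s (suc k ∸ j + i) x          ≡⟨ iter-+ s (suc k ∸ j) i x ⟩
        iter s (suc k ∸ j) (iter s i x)   ≡⟨ cong (iter s (suc k ∸ j)) iterᵢ≡iterⱼ ⟩
        iter s (suc k ∸ j) (iter s j x)   ≡⟨ iter-+ s (suc k ∸ j) j x ⟨
        iter s (suc k ∸ j + j) x          ≡⟨ cong (λ r → iter s r x) (m∸n+n≡m (<⇒≤ j<q)) ⟩
        iter s (suc k) x                  ≡⟨ returns ⟩
        x                                 ∎)

  InOrbitOf : ℕ → ℕ → Set
  InOrbitOf n y = ∃ λ k → y ≡ iter s k n

  cycleThroughPeriodicPoint : ∀ {x} p → 0 < x → iter s (suc p) x ≡ x →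
                              ∃ λ cyc → IsCycle m b cyc × All (InOrbitOf x) cyc
  cycleThroughPeriodicPoint {x} p 0<x returns
    with k , returnsₖ , minimal ← least-witness {P = λ j → iter s (suc j) x ≡ x} (λ j → iter s (suc j) x ≟ x) {p} returns
    = orbitList x (suc k) , orbitList-isCycle k 0<x returnsₖ minimal , All.applyUpTo⁺₂ _ (suc k) (λ j → j , refl)

  cycleInOrbit : ∀ {n} → 0 < n → ∃ λ cyc → IsCycle m b cyc × All (InOrbitOf n) cyc
  cycleInOrbit {n} 0<n
    with B , n≤B , invariant ← invariantSegment s _ (proj₂ (S-contracting c m)) n
    with i , suc p , _ , returns ← periodicPointInOrbit s invariant n≤B
    with cyc , isCycle , inOrbit ← cycleThroughPeriodicPoint p (iter-preserves s {P = 0 <_} (S-pos c m _) i 0<n) returns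
    = cyc , isCycle , All.map (λ { (k , refl) → k + i , sym (iter-+ s k i n) }) inOrbit

  atLeastCycles-residues : ∀ g .{{_ : NonZero g}} → g ∣ 1 + c → PowFixesResidues m g → AtLeastCycles m b g
  atLeastCycles-residues g g∣b-1 fix =
    applyUpTo cycleOf g , length-applyUpTo cycleOf g ,
    All.applyUpTo⁺₂ cycleOf g (λ r → proj₁ (proj₂ (cycleInOrbit (0<g+ r)))) ,
    AllPairs.applyUpTo⁺₁ cycleOf g notSameCycle
    where
    0<g+ : ∀ r → 0 < g + r
    0<g+ r = ≤-trans (>-nonZero⁻¹ g) (m≤m+n g r)
    cycleOf : ℕ → List ℕ
    cycleOf r = proj₁ (cycleInOrbit (0<g+ r))
    residue≡ : ∀ {r} → r < g → All (λ y → y % g ≡ r) (cycleOf r)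
    residue≡ {r} r<g = All.map inResidueClass (proj₂ (proj₂ (cycleInOrbit (0<g+ r))))
      where
      inResidueClass : ∀ {y} → InOrbitOf (g + r) y → y % g ≡ r
      inResidueClass (k , refl) = begin
        iter s k (g + r) % g    ≡⟨ iter-preserves s {P = λ y → y % g ≡ (g + r) % g} (λ {y} → trans (S-mod c {m} g∣b-1 fix y)) k refl ⟩
        (g + r) % g             ≡⟨ cong (_% g) (+-comm g r) ⟩
        (r + g) % g             ≡⟨ [m+n]%n≡m%n r g ⟩
        r % g                   ≡⟨ m<n⇒m%n≡m r<g ⟩
        r                       ∎
        where open ≡-Reasoning
    notSameCycle : ∀ {i j} → i < j → j < g → ¬ SameCycle (cycleOf i) (cycleOf j)
    notSameCycle {i} {j} i<j j<g (k , rotated≡) =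
      headsDiffer (cycleOf j) (IsCycle.nonempty (proj₁ (proj₂ (cycleInOrbit (0<g+ j)))))
        (subst (All _) rotated≡ (rotate-All k (cycleOf i) (residue≡ (<-trans i<j j<g)))) (residue≡ j<g)
      where
      headsDiffer : ∀ cyc → cyc ≢ [] → All (λ y → y % g ≡ i) cyc → All (λ y → y % g ≡ j) cyc → ⊥
      headsDiffer [] nonempty _ _ = nonempty refl
      headsDiffer (y ∷ _) _ (y%g≡i ∷ _) (y%g≡j ∷ _) = <⇒≢ i<j (trans (sym y%g≡i) y%g≡j)

atLeastCycles-gcd : ∀ m c → 1 ≤ m → AtLeastCycles m (2 + c) (gcd (1 + c) (N m (2 + c)))
atLeastCycles-gcd m c 1≤m =
  atLeastCycles-residues m c (gcd (1 + c) (N m b)) {{≢-nonZero (gcd[m,n]≢0 (1 + c) (N m b) (inj₁ λ ()))}}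
    gcd∣b-1 (powFixesResidues-∏factorN m b 1≤m (suc (m + b)) gcd∣b-1 (gcd[m,n]∣n (1 + c) (N m b)))
  where
  b : ℕ
  b = 2 + c
  gcd∣b-1 : gcd (1 + c) (N m b) ∣ 1 + c
  gcd∣b-1 = gcd[m,n]∣m (1 + c) (N m b)

proposition6p1 : ((m b : ℕ) → 2 ≤ m → 2 ≤ b → AtLeastCycles m b (gcd (b ∸ 1) (N m b)))
    × ((m k b : ℕ) → 5 ≤ m → Prime m → 1 ≤ k → b ≡ m * k + 1 → AtLeastCycles m b m)
proposition6p1 = gcdManyCycles , primeManyCycles
  where
  gcdManyCycles : (m b : ℕ) → 2 ≤ m → 2 ≤ b → AtLeastCycles m b (gcd (b ∸ 1) (N m b))
  gcdManyCycles m (suc zero) _ (s≤s ())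
  gcdManyCycles m (suc (suc c)) 2≤m _ = atLeastCycles-gcd m c (≤-trans (s≤s z≤n) 2≤m)

  primeManyCycles : (m k b : ℕ) → 5 ≤ m → Prime m → 1 ≤ k → b ≡ m * k + 1 → AtLeastCycles m b m
  primeManyCycles m k b 5≤m pr (s≤s z≤n) refl =
    atLeastCycles-≤ m≤gcd (gcdManyCycles m b 2≤m (≤-trans 2≤m (≤-trans m≤b-1 (m∸n≤m b 1))))
    where
    2≤m : 2 ≤ m
    2≤m = ≤-trans (s≤s (s≤s z≤n)) 5≤m
    b-1≡mk : b ∸ 1 ≡ m * k
    b-1≡mk = m+n∸n≡m (m * k) 1
    m≤b-1 : m ≤ b ∸ 1
    m≤b-1 = subst (m ≤_) (sym b-1≡mk) (m≤m*n m k)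
    instance
      b-1≢0 : NonZero (b ∸ 1)
      b-1≢0 = >-nonZero (≤-trans (≤-trans (s≤s z≤n) 2≤m) m≤b-1)
    m≤gcd : m ≤ gcd (b ∸ 1) (N m b)
    m≤gcd = ∣⇒≤ {{≢-nonZero (gcd[m,n]≢0 (b ∸ 1) (N m b) (inj₁ (≢-nonZero⁻¹ (b ∸ 1))))}}
      (gcd-greatest (divides k (trans b-1≡mk (*-comm m k))) (prime∣N {m} {b} pr m≤b-1 ∣-refl))
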